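{- Let $k\ge1$, $d\ge1$, let $\mathcal{S}_1,\dots,\mathcal{S}_{2^k-1}$ be an enumeration of the nonempty subsets of $[k]$, and let $\mathcal{D}_{\mathcal{S}}\subseteq[d]$ be given for each nonempty $\mathcal{S}\subseteq[k]$. With $\mathcal{E}_i^\ell$, $\mathcal{F}_i^{\ell_1,\ell_2}$ and $\mathcal{B}_i$ as defined below, for every $\ell\in[2^k-1]$, \[ \bigcup_{i\in\mathcal{S}_\ell}\mathcal{B}_i=\Big(\bigcup_{i\in\mathcal{S}_\ell}\mathcal{E}_i^\ell\Big)\cup\Big(\bigcup_{i\in\mathcal{S}_\ell}\ \bigcup_{\ell\le\ell_1<\ell_2:\ i\in\mathcal{S}_{\ell_1}\cap\mathcal{S}_{\ell_2}}\mathcal{F}_i^{\ell_1,\ell_2}\Big). \]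
   Context: For $i\in[k]$ and $\ell\in[2^k-1]$, $\mathcal{E}_i^\ell:=\bigcap_{\ell'\ge\ell,\ i\in\mathcal{S}_{\ell'}}\mathcal{D}_{\mathcal{S}_{\ell'}}$ (an empty intersection is $[d]$). For $1\le\ell_1<\ell_2\le2^k-1$ and $i\in\mathcal{S}_{\ell_1}\cap\mathcal{S}_{\ell_2}$, $\mathcal{F}_i^{\ell_1,\ell_2}:=\mathcal{E}_i^{\ell_1+1}\setminus\bigcup_{i'\in\mathcal{S}_{\ell_2}}\mathcal{E}_{i'}^{\ell_1}$. For $i\in[k]$, $\mathcal{B}_i:=\mathcal{E}_i^1\cup\bigcup_{\ell_1<\ell_2:\ i\in\mathcal{S}_{\ell_1}\cap\mathcal{S}_{\ell_2}}\mathcal{F}_i^{\ell_1,\ell_2}$. -}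

module Defs where

open import Data.Nat using (ℕ; suc; _^_; _∸_)
open import Data.Fin using (Fin; toℕ)
open import Data.Fin.Subset using (Subset; _∈_; _∉_; Nonempty)
open import Data.Product using (Σ; ∃; ∃-syntax; _×_)
open import Data.Sum using (_⊎_)
open import Relation.Nullary using (¬_)
open import Relation.Binary.PropositionalEquality using (_≡_)
import Data.Nat as ℕ
import Data.Fin as F

-- Number of nonempty subsets of [k]: 2^k - 1.
N : ℕ → ℕ
N k = 2 ^ k ∸ 1

-- Indices ℓ ∈ [2^k-1] are represented 0-based by Fin (N k); the paper's
-- index ℓ corresponds to toℕ ℓ + 1 here.

module Sets {k d : ℕ}
            (S : Fin (N k) → Subset k)
            (D : Subset k → Subset d)       -- D_S for each S (only used at nonempty S)
            where

  -- E i ℓ  (ℓ a 0-based index in ℕ, possibly = N k, in which case the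
  -- intersection is empty and E i ℓ = [d]):
  --   E_i^ℓ = ⋂_{ℓ' ≥ ℓ, i ∈ S_ℓ'} D_{S_ℓ'}
  E : Fin k → ℕ → Fin d → Set
  E i ℓ x = ∀ (ℓ' : Fin (N k)) → ℓ ℕ.≤ toℕ ℓ' → i ∈ S ℓ' → x ∈ D (S ℓ')

  -- F_i^{ℓ₁,ℓ₂} = E_i^{ℓ₁+1} \ ⋃_{i' ∈ S_ℓ₂} E_{i'}^{ℓ₁}
  -- (only used for ℓ₁ < ℓ₂ and i ∈ S_ℓ₁ ∩ S_ℓ₂)
  F : Fin k → Fin (N k) → Fin (N k) → Fin d → Set
  F i ℓ₁ ℓ₂ x = E i (suc (toℕ ℓ₁)) x × ¬ (∃[ i' ] (i' ∈ S ℓ₂ × E i' (toℕ ℓ₁) x))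

  -- B_i = E_i^1 ∪ ⋃_{ℓ₁ < ℓ₂, i ∈ S_ℓ₁ ∩ S_ℓ₂} F_i^{ℓ₁,ℓ₂}
  -- (paper's E_i^1 is 0-based E i 0)
  B : Fin k → Fin d → Set
  B i x = E i 0 x
        ⊎ ∃[ ℓ₁ ] ∃[ ℓ₂ ] (ℓ₁ F.< ℓ₂ × i ∈ S ℓ₁ × i ∈ S ℓ₂ × F i ℓ₁ ℓ₂ x)

IsEnumeration : {k : ℕ} → (Fin (N k) → Subset k) → Set
IsEnumeration {k} S =
    (∀ ℓ ℓ' → S ℓ ≡ S ℓ' → ℓ ≡ ℓ')
  × (∀ ℓ → Nonempty (S ℓ))
  × (∀ (T : Subset k) → Nonempty T → ∃[ ℓ ] (S ℓ ≡ T))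

module Submission where

-- Fix ℓ and a point x, and write ⋃E m, ⋃B, ⋃F for the unions
-- over i ∈ S_ℓ of E_i^m, B_i and of the F_i^{ℓ₁,ℓ₂} with ℓ ≤ ℓ₁ < ℓ₂.
--   * E_i^m is an intersection over the indices ≥ m, so it grows with m.
--     Hence E_i^1 ⊆ E_i^ℓ, and a set F_i^{ℓ₁,ℓ₂} with ℓ₁ < ℓ lies in
--     E_i^{ℓ₁+1} ⊆ E_i^ℓ; the remaining F's have ℓ ≤ ℓ₁.  This gives ⊆.
--   * For ⊇ only ⋃E ℓ ⊆ ⋃B needs work.  We descend from m = ℓ towards 0:
--     if x ∈ ⋃E m with m = m' + 1 ≤ ℓ, either x ∈ ⋃E m' already (continue
--     the descent) or x lies in E_i^{m'+1} but in no E_{i'}^{m'}, i' ∈ S_ℓ.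
--     In the latter case i ∈ S_{m'} (otherwise E_i^{m'} = E_i^{m'+1}), so
--     x ∈ F_i^{m',ℓ} ⊆ B_i.  At m = 0 we have x ∈ E_i^1 ⊆ B_i directly.
--     The case distinction is constructive because all sets are finite,
--     so membership in E_i^m is decidable.

open import Defs
open import Data.Nat using (ℕ; _≥_)
open import Data.Fin using (Fin; toℕ; _<_; _≤_)
open import Data.Fin.Subset using (Subset; _∈_; _∉_)
open import Data.Product using (∃-syntax; _×_)
open import Data.Sum using (_⊎_)
open import Function.Bundles using (_⇔_)

import Data.Nat as ℕ
import Data.Nat.Properties as ℕP
import Data.Fin as F
import Data.Fin.Properties as FP
open import Data.Fin.Subset.Properties using (_∈?_)
open import Data.Product using (_,_; proj₁)
open import Data.Sum using (inj₁; inj₂)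
open import Relation.Nullary using (Dec; yes; no; ¬_; contradiction)
open import Relation.Nullary.Decidable using (_×-dec_; _→-dec_)
open import Relation.Binary.PropositionalEquality using (_≡_; refl)
open import Function.Bundles using (mk⇔)

lowerIndex : ∀ {n} (ℓ : Fin n) {m : ℕ} → m ℕ.< toℕ ℓ
           → ∃[ ℓ₁ ] (toℕ ℓ₁ ≡ m × ℓ₁ F.< ℓ)
lowerIndex {n} ℓ {m} m<ℓ = ℓ₁ , toℕ-ℓ₁ , ℓ₁<ℓ
  where
    ℓ₁ : Fin n
    ℓ₁ = F.fromℕ< (ℕP.<-trans m<ℓ (FP.toℕ<n ℓ))
    toℕ-ℓ₁ : toℕ ℓ₁ ≡ m
    toℕ-ℓ₁ = FP.toℕ-fromℕ< _
    ℓ₁<ℓ : ℓ₁ F.< ℓ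
    ℓ₁<ℓ rewrite toℕ-ℓ₁ = m<ℓ

module Properties {k d : ℕ} (S : Fin (N k) → Subset k) (D : Subset k → Subset d) where
  open Sets S D

  E? : ∀ i m x → Dec (E i m x)
  E? i m x = FP.all? (λ ℓ' → (m ℕ.≤? toℕ ℓ') →-dec ((i ∈? S ℓ') →-dec (x ∈? D (S ℓ'))))

  E-mono : ∀ {i m m' x} → m ℕ.≤ m' → E i m x → E i m' x
  E-mono m≤m' e ℓ' m'≤ℓ' = e ℓ' (ℕP.≤-trans m≤m' m'≤ℓ')

  -- If i ∉ S_ℓ₁, the index ℓ₁ does not contribute to E_i^{ℓ₁},
  -- so E_i^{ℓ₁} = E_i^{ℓ₁+1}.
  E-skip : ∀ {i x} ℓ₁ → i ∉ S ℓ₁ → E i (ℕ.suc (toℕ ℓ₁)) x → E i (toℕ ℓ₁) x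
  E-skip ℓ₁ i∉ e ℓ' ℓ₁≤ℓ' i∈ with ℕP.m≤n⇒m<n∨m≡n ℓ₁≤ℓ'
  ... | inj₁ ℓ₁<ℓ' = e ℓ' ℓ₁<ℓ' i∈
  ... | inj₂ ℓ₁≡ℓ' rewrite FP.toℕ-injective ℓ₁≡ℓ' = contradiction i∈ i∉

  leave : ∀ {i x ℓ₁ ℓ₂} → ℓ₁ F.< ℓ₂ → i ∈ S ℓ₂ → E i (ℕ.suc (toℕ ℓ₁)) x
        → ¬ (∃[ i' ] (i' ∈ S ℓ₂ × E i' (toℕ ℓ₁) x)) → B i x
  leave {i} {x} {ℓ₁} {ℓ₂} ℓ₁<ℓ₂ i∈ℓ₂ e none with i ∈? S ℓ₁
  ... | yes i∈ℓ₁ = inj₂ (ℓ₁ , ℓ₂ , ℓ₁<ℓ₂ , i∈ℓ₁ , i∈ℓ₂ , e , none)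
  ... | no i∉ℓ₁ = contradiction (i , i∈ℓ₂ , E-skip ℓ₁ i∉ℓ₁ e) none

  module AtIndex (ℓ : Fin (N k)) (x : Fin d) where
    ⋃E : ℕ → Set
    ⋃E m = ∃[ i ] (i ∈ S ℓ × E i m x)

    ⋃B : Set
    ⋃B = ∃[ i ] (i ∈ S ℓ × B i x)

    ⋃F : Set
    ⋃F = ∃[ i ] (i ∈ S ℓ × ∃[ ℓ₁ ] ∃[ ℓ₂ ]
           (ℓ F.≤ ℓ₁ × ℓ₁ F.< ℓ₂ × i ∈ S ℓ₁ × i ∈ S ℓ₂ × F i ℓ₁ ℓ₂ x))

    ⋃E? : ∀ m → Dec (⋃E m)
    ⋃E? m = FP.any? (λ i → (i ∈? S ℓ) ×-dec E? i m x)

    ⋃B⊆⋃E⊎⋃F : ⋃B → ⋃E (toℕ ℓ) ⊎ ⋃F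
    ⋃B⊆⋃E⊎⋃F (i , i∈ , inj₁ e) = inj₁ (i , i∈ , E-mono ℕ.z≤n e)
    ⋃B⊆⋃E⊎⋃F (i , i∈ , inj₂ (ℓ₁ , ℓ₂ , ℓ₁<ℓ₂ , i∈ℓ₁ , i∈ℓ₂ , f)) with toℕ ℓ ℕP.≤? toℕ ℓ₁
    ... | yes ℓ≤ℓ₁ = inj₂ (i , i∈ , ℓ₁ , ℓ₂ , ℓ≤ℓ₁ , ℓ₁<ℓ₂ , i∈ℓ₁ , i∈ℓ₂ , f)
    ... | no ℓ≰ℓ₁ = inj₁ (i , i∈ , E-mono (ℕP.≰⇒> ℓ≰ℓ₁) (proj₁ f))

    descent : ∀ m → m ℕ.≤ toℕ ℓ → ⋃E m → ⋃B
    descent ℕ.zero _ (i , i∈ , e) = i , i∈ , inj₁ e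
    descent (ℕ.suc m) m<ℓ hit with ⋃E? m
    ... | yes earlier = descent m (ℕP.≤-trans (ℕP.n≤1+n m) m<ℓ) earlier
    ... | no none with lowerIndex ℓ m<ℓ | hit
    ...   | ℓ₁ , refl , ℓ₁<ℓ | i , i∈ , e = i , i∈ , leave ℓ₁<ℓ i∈ e none

    ⋃E⊎⋃F⊆⋃B : ⋃E (toℕ ℓ) ⊎ ⋃F → ⋃B
    ⋃E⊎⋃F⊆⋃B (inj₁ hit) = descent (toℕ ℓ) ℕP.≤-refl hit
    ⋃E⊎⋃F⊆⋃B (inj₂ (i , i∈ , ℓ₁ , ℓ₂ , _ , ℓ₁<ℓ₂ , i∈ℓ₁ , i∈ℓ₂ , f)) =
      i , i∈ , inj₂ (ℓ₁ , ℓ₂ , ℓ₁<ℓ₂ , i∈ℓ₁ , i∈ℓ₂ , f)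

lemma7 : (k d : ℕ) → k ≥ 1 → d ≥ 1
    → (S : Fin (N k) → Subset k) → IsEnumeration S
    → (D : Subset k → Subset d)
    → let open Sets S D in
    (ℓ : Fin (N k)) (x : Fin d)
    → (∃[ i ] (i ∈ S ℓ × B i x))
    ⇔ ((∃[ i ] (i ∈ S ℓ × E i (toℕ ℓ) x))
    ⊎ (∃[ i ] (i ∈ S ℓ × ∃[ ℓ₁ ] ∃[ ℓ₂ ] (ℓ ≤ ℓ₁ × ℓ₁ < ℓ₂ × i ∈ S ℓ₁ × i ∈ S ℓ₂ × F i ℓ₁ ℓ₂ x))))
lemma7 k d _ _ S _ D ℓ x = mk⇔ ⋃B⊆⋃E⊎⋃F ⋃E⊎⋃F⊆⋃B
  where open Properties.AtIndex S D ℓ x
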